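{- Let $d$ be a positive integer and let $G=(V,E)$ be a $(d+1)$-claw free graph with budget function $b:V\to\mathbb{Z}^+$ and a positive integer $B$. Let $A$ be the set returned by the Minimum Budget First algorithm (MBF) on this input, and let $A^*$ be a maximum-cardinality $B$-budgeted independent set of $G$. Then $|A^*|\le d|A|$.
   Context: A graph is $(d+1)$-claw free if it contains no induced subgraph isomorphic to $K_{1,d+1}$. The budget of $S\subseteq V$ is $\sum_{v\in S}b(v)$; a $B$-budgeted independent set is an independent set with budget at most $B$. MBF: order the vertices as $v_1,\dots,v_n$ in non-decreasing order of budget ($b_i=b(v_i)$). Set $A_1=\{v_1\}$ and $B_2=B-b_1$. For $i=2,\dots,n$: if $B_i<b_i$, stop and return $A_{i-1}$; otherwise, if $A_{i-1}\cup\{v_i\}$ is independent, set $A_i=A_{i-1}\cup\{v_i\}$ and $B_{i+1}=B_i-b_i$, else set $A_i=A_{i-1}$ and $B_{i+1}=B_i$. If the loop finishes, return $A_n$. -}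

module Defs where

open import Data.Nat using (ℕ; zero; suc; _+_; _∸_; _<_; _≤_; _<?_)
open import Data.Bool using (Bool; true; false; if_then_else_; _∨_; not)
open import Data.Fin using (Fin; zero; suc)
open import Data.List using (List; []; _∷_; length; map; tabulate)
open import Data.Nat.ListAction using (sum)
open import Data.Bool.ListAction using (any)
open import Data.List.Membership.Propositional using (_∈_)
open import Data.List.Relation.Unary.All using (All)
open import Data.List.Relation.Unary.Unique.Propositional using (Unique)
open import Data.Fin.Subset using (Subset) renaming (_∈_ to _∈ₛ_)
open import Data.Vec using (Vec; []; _∷_)
open import Data.List using (_∷_)
open import Data.Product using (Σ; _×_)
open import Relation.Binary.PropositionalEquality using (_≡_)
open import Relation.Nullary using (¬_; yes; no)

record Graph (n : ℕ) : Set where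
  field
    adj   : Fin n → Fin n → Bool
    sym   : ∀ u v → adj u v ≡ adj v u
    irrefl : ∀ v → adj v v ≡ false

open Graph public

Edge : ∀ {n} → Graph n → Fin n → Fin n → Set
Edge G u v = adj G u v ≡ true

HasInducedClaw : ∀ {n} → Graph n → ℕ → Set
HasInducedClaw {n} G k =
  Σ (Fin n) λ c → Σ (List (Fin n)) λ L →
    (length L ≡ k) × Unique L × All (Edge G c) L ×
    (∀ u v → u ∈ L → v ∈ L → ¬ Edge G u v)

ClawFree : ∀ {n} → Graph n → ℕ → Set
ClawFree G k = ¬ HasInducedClaw G k

members : ∀ {n} → Subset n → List (Fin n)
members [] = []
members (true ∷ S) = zero ∷ map suc (members S)
members (false ∷ S) = map suc (members S)

budget : ∀ {n} → (Fin n → ℕ) → Subset n → ℕ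
budget b S = sum (map b (members S))

Independent : ∀ {n} → Graph n → Subset n → Set
Independent G S = ∀ u v → u ∈ₛ S → v ∈ₛ S → ¬ Edge G u v

BudgetedIndependent : ∀ {n} → Graph n → (Fin n → ℕ) → ℕ → Subset n → Set
BudgetedIndependent G b B S = Independent G S × budget b S ≤ B

MaxBudgetedIndependent : ∀ {n} → Graph n → (Fin n → ℕ) → ℕ → Subset n → Set
MaxBudgetedIndependent {n} G b B S =
  BudgetedIndependent G b B S ×
  (∀ (T : Subset n) → BudgetedIndependent G b B T →
     Data.Fin.Subset.∣ T ∣ ≤ Data.Fin.Subset.∣ S ∣)

-- Budgets are non-decreasing along the vertex order v_1,...,v_n = 0,...,n-1.
Sorted : ∀ {n} → (Fin n → ℕ) → Set
Sorted {n} b = ∀ (i j : Fin n) → Data.Fin._≤_ i j → b i ≤ b j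

-- Bi is the remaining budget B_i, A the current set A_{i-1}
-- (as a list), and the list holds v_i, v_{i+1}, ..., v_n.
-- Since A_{i-1} is independent, A_{i-1} ∪ {v_i} is independent iff v_i is
-- adjacent to no member of A_{i-1} (v_i ∉ A_{i-1} and there are no loops).
mbfLoop : ∀ {n} → Graph n → (Fin n → ℕ) → ℕ → List (Fin n) → List (Fin n) → List (Fin n)
mbfLoop G b Bi A [] = A
mbfLoop G b Bi A (v ∷ vs) with Bi <? b v
... | yes _ = A
... | no _ = if any (λ u → adj G u v) A
              then mbfLoop G b Bi A vs
              else mbfLoop G b (Bi ∸ b v) (v ∷ A) vs

-- MBF on vertices 0,...,n-1 (assumed ordered by non-decreasing budget):
-- A_1 = {v_1}, B_2 = B - b_1.  (With b positive, truncated subtraction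
-- gives the same run as integer subtraction: if B < b_1 then B_2 = 0 < b_2.)
mbf : ∀ {n} → Graph n → (Fin n → ℕ) → ℕ → List (Fin n)
mbf {zero} G b B = []
mbf {suc m} G b B = mbfLoop G b (B ∸ b zero) (zero ∷ []) (tabulate {n = m} suc)

module Submission where

-- Let X be any B-budgeted independent set.  Run MBF and
-- record, while it scans the vertices in order, the list Lx of already
-- scanned vertices of X.  Every such vertex is either in the current
-- solution A or adjacent to a vertex of A ("covered by A"), and a vertex a
-- of A covers at most d vertices of X: only itself if a ∈ X, otherwise
-- pairwise non-adjacent neighbours, of which (d+1)-claw-freeness allows at
-- most d.  Hence |Lx| ≤ d|A| throughout, which settles the case where MBF
-- scans every vertex.  If MBF stops early at a vertex v that does not fit
-- the remaining budget, an exchange invariant on budgets (Exchange below)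
-- shows that more than d|A| vertices of X would cost at least
-- budget(A) + b(v) > B, so again |X| ≤ d|A|.

open import Defs hiding (sym)
open import Data.Nat using (ℕ; zero; suc; _+_; _*_; _∸_; _≤_; _<_; _≤?_; z≤n; s≤s; s≤s⁻¹)
open import Data.Nat.Properties
open import Data.Nat.ListAction using (sum)
open import Data.Nat.Tactic.RingSolver using (solve-∀)
open import Data.Bool as Bool using (true; false)
open import Data.Bool.Properties using (T-≡)
open import Data.Bool.ListAction using (any)
open import Data.Fin as Fin using (Fin; zero; suc)
open import Data.Fin.Subset using (Subset; ∣_∣; inside; outside) renaming (_∈_ to _∈ₛ_)
open import Data.Fin.Subset.Properties using () renaming (_∈?_ to _∈ₛ?_)
open import Data.Vec using ([]; _∷_)
open import Data.List using (List; []; _∷_; length; map; filter; take; tabulate; allFin)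
open import Data.List.Properties using (map-tabulate; length-map; length-take; filter-accept; filter-reject)
open import Data.List.Membership.Propositional using (_∈_; _∉_)
open import Data.List.Relation.Unary.All as All using (All; []; _∷_)
open import Data.List.Relation.Unary.All.Properties as All using (all-filter; ¬Any⇒All¬)
open import Data.List.Relation.Unary.Any as Any using (Any; here; there)
open import Data.List.Relation.Unary.Any.Properties using (any⁻)
open import Data.List.Relation.Unary.AllPairs as AllPairs using (AllPairs; []; _∷_)
import Data.List.Relation.Unary.AllPairs.Properties as AllPairsₚ
open import Data.List.Relation.Unary.Unique.Propositional using (Unique)
import Data.List.Relation.Unary.Unique.Propositional.Properties as Unique
open import Data.Product using (_×_; _,_)
open import Data.Sum using (_⊎_; inj₁; inj₂)
open import Function.Bundles using (Equivalence)
open import Relation.Binary.PropositionalEquality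
open import Relation.Nullary using (¬_; does; yes; no; contradiction; _⊎-dec_)
open import Relation.Unary using (Pred; Decidable)
open import Relation.Unary.Properties using (∁?)

filter-suc : ∀ {n} x (X : Subset n) (L : List (Fin n)) →
  filter (_∈ₛ? (x ∷ X)) (map suc L) ≡ map suc (filter (_∈ₛ? X) L)
filter-suc x X [] = refl
filter-suc x X (i ∷ L) with does (i ∈ₛ? X)
... | true  = cong (suc i ∷_) (filter-suc x X L)
... | false = filter-suc x X L

shift-members : ∀ {n} x (X : Subset n) → members X ≡ filter (_∈ₛ? X) (allFin n) →
  map suc (members X) ≡ filter (_∈ₛ? (x ∷ X)) (tabulate suc)
shift-members {n} x X members≡ = begin
  map suc (members X)                         ≡⟨ cong (map suc) members≡ ⟩
  map suc (filter (_∈ₛ? X) (allFin n))        ≡⟨ filter-suc x X (allFin n) ⟨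
  filter (_∈ₛ? (x ∷ X)) (map suc (allFin n))  ≡⟨ cong (filter (_∈ₛ? (x ∷ X))) (map-tabulate (λ i → i) suc) ⟩
  filter (_∈ₛ? (x ∷ X)) (tabulate suc)        ∎
  where open ≡-Reasoning

members-filter : ∀ {n} (X : Subset n) → members X ≡ filter (_∈ₛ? X) (allFin n)
members-filter [] = refl
members-filter (inside ∷ X)  = cong (zero ∷_) (shift-members inside X (members-filter X))
members-filter (outside ∷ X) = shift-members outside X (members-filter X)

size-members : ∀ {n} (X : Subset n) → ∣ X ∣ ≡ length (members X)
size-members [] = refl
size-members (inside ∷ X)  = cong suc (trans (size-members X) (sym (length-map suc (members X))))
size-members (outside ∷ X) = trans (size-members X) (sym (length-map suc (members X)))

length-split : ∀ {a p} {A : Set a} {P : Pred A p} (P? : Decidable P) (L : List A) →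
  length L ≡ length (filter P? L) + length (filter (∁? P?) L)
length-split P? [] = refl
length-split P? (x ∷ L) with does (P? x)
... | true  = cong suc (length-split P? L)
... | false = trans (cong suc (length-split P? L)) (sym (+-suc _ _))

unique-constant : ∀ {a} {A : Set a} {c : A} (L : List A) → Unique L → All (_≡ c) L → length L ≤ 1
unique-constant [] _ _ = z≤n
unique-constant (x ∷ []) _ _ = s≤s z≤n
unique-constant (x ∷ y ∷ L) ((x≢y ∷ _) ∷ _) (refl ∷ refl ∷ _) = contradiction refl x≢y

move-one : ∀ {a} {A : Set a} {N} (x : A) (L R : List A) →
  length (x ∷ L) + length R ≤ N → length L + length (x ∷ R) ≤ N
move-one {N = N} x L R = subst (_≤ N) (sym (+-suc (length L) (length R)))

weight : ∀ {n} → (Fin n → ℕ) → List (Fin n) → ℕ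
weight b L = sum (map b L)

weight-lower : ∀ {n} (b : Fin n → ℕ) {c} (L : List (Fin n)) → All (λ w → c ≤ b w) L →
  length L * c ≤ weight b L
weight-lower b [] [] = z≤n
weight-lower b (v ∷ L) (c≤bv ∷ cheap) = +-mono-≤ c≤bv (weight-lower b L cheap)

-- Exchange d a wA ℓ wL c₀ relates a solution with a elements of total
-- weight wA to ℓ covered vertices of X of weight wL: once ℓ plus k+1
-- further vertices of price c ≥ c₀ outnumber d·a, these weigh at least
-- wA + c.  It is what turns "MBF stopped" into "X is over budget".
record Exchange (d a wA ℓ wL c₀ : ℕ) : Set where
  constructor exchanging
  field
    outweighs : ∀ k c → c₀ ≤ c → d * a < ℓ + suc k → wA + c ≤ wL + suc k * c

open Exchange

exchange-initial : ∀ d c₀ → Exchange d 0 0 0 0 c₀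
exchange-initial d c₀ = exchanging λ k c _ _ → m≤m+n c (k * c)

exchange-raise : ∀ {d a wA ℓ wL c₀ c₁} → Exchange d a wA ℓ wL c₀ → c₀ ≤ c₁ → Exchange d a wA ℓ wL c₁
exchange-raise E c₀≤c₁ = exchanging λ k c c₁≤c → outweighs E k c (≤-trans c₀≤c₁ c₁≤c)

price-swap : ∀ w p k c → w + (p + k * c) + c ≡ p + w + suc k * c
price-swap = solve-∀

peel-price : ∀ w p k → w + suc (suc k) * p ≡ w + (p + k * p) + p
peel-price = solve-∀

add-price : ∀ c w k → c + (w + suc k * c) ≡ w + suc (suc k) * c
add-price = solve-∀

exchange-cover : ∀ {d a wA ℓ wL c₀ p} → Exchange d a wA ℓ wL c₀ → c₀ ≤ p →
  Exchange d a wA (suc ℓ) (p + wL) p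
outweighs (exchange-cover {d} {a} {wA} {ℓ} {wL} {p = p} E c₀≤p) k c p≤c more = begin
  wA + c                    ≤⟨ +-monoˡ-≤ c wA≤ ⟩
  wL + (p + k * p) + c      ≤⟨ +-monoˡ-≤ c (+-monoʳ-≤ wL (+-monoʳ-≤ p (*-monoʳ-≤ k p≤c))) ⟩
  wL + (p + k * c) + c      ≡⟨ price-swap wL p k c ⟩
  p + wL + suc k * c        ∎
  where
  open ≤-Reasoning
  wA+p≤ : wA + p ≤ wL + suc (suc k) * p
  wA+p≤ = outweighs E (suc k) p c₀≤p (subst (d * a <_) (sym (+-suc ℓ (suc k))) more)
  wA≤ : wA ≤ wL + (p + k * p)
  wA≤ = +-cancelʳ-≤ p wA _ (subst (wA + p ≤_) (peel-price wL p k) wA+p≤)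

-- For 1 ≤ d, adding one element to the solution costs d further vertices
-- in the count, so at least one of them can be dropped.
count-drop : ∀ {d a x k} → 1 ≤ d → d * suc a < x + suc k → d * a < x + k
count-drop {d} {a} {x} {k} 1≤d more = s≤s⁻¹ (begin-strict
  suc (d * a)     ≤⟨ +-monoˡ-≤ (d * a) 1≤d ⟩
  d + d * a       ≡⟨ *-suc d a ⟨
  d * suc a       <⟨ more ⟩
  x + suc k       ≡⟨ +-suc x k ⟩
  suc (x + k)     ∎)
  where open ≤-Reasoning

exchange-accept : ∀ {d a wA ℓ wL c₀ p} → 1 ≤ d → ℓ ≤ d * a → Exchange d a wA ℓ wL c₀ → c₀ ≤ p →
  Exchange d (suc a) (p + wA) ℓ wL p
outweighs (exchange-accept {d} {a} {ℓ = ℓ} 1≤d ℓ≤ E c₀≤p) zero c p≤c more =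
  contradiction (subst (d * a <_) (+-identityʳ ℓ) (count-drop 1≤d more)) (≤⇒≯ ℓ≤)
outweighs (exchange-accept {wA = wA} {wL = wL} {p = p} 1≤d ℓ≤ E c₀≤p) (suc k) c p≤c more = begin
  p + wA + c                ≡⟨ +-assoc p wA c ⟩
  p + (wA + c)              ≤⟨ +-mono-≤ p≤c (outweighs E k c (≤-trans c₀≤p p≤c) (count-drop 1≤d more)) ⟩
  c + (wL + suc k * c)      ≡⟨ add-price c wL k ⟩
  wL + suc (suc k) * c      ∎
  where open ≤-Reasoning

exchange-accept-cover : ∀ {d a wA ℓ wL c₀ p} → 1 ≤ d → Exchange d a wA ℓ wL c₀ → c₀ ≤ p →
  Exchange d (suc a) (p + wA) (suc ℓ) (p + wL) p
outweighs (exchange-accept-cover {d} {a} {wA} {ℓ} {wL} {p = p} 1≤d E c₀≤p) k c p≤c more = begin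
  p + wA + c                ≡⟨ +-assoc p wA c ⟩
  p + (wA + c)              ≤⟨ +-monoʳ-≤ p (outweighs E k c (≤-trans c₀≤p p≤c) fewer) ⟩
  p + (wL + suc k * c)      ≡⟨ +-assoc p wL (suc k * c) ⟨
  p + wL + suc k * c        ∎
  where
  open ≤-Reasoning
  fewer : d * a < ℓ + suc k
  fewer = subst (d * a <_) (sym (+-suc ℓ k)) (count-drop {x = suc ℓ} 1≤d more)

-- The exchange invariant at the moment MBF stops: if the remaining budget
-- Bi is below the price p of the current vertex and the remaining m
-- vertices of X cost at least p each, then ℓ + m ≤ d·a, since otherwise
-- the vertices of X would cost more than the budget Bi + wA.
exchange-stop : ∀ {d a wA ℓ wL c₀ p m W Bi} → Exchange d a wA ℓ wL c₀ → ℓ ≤ d * a → c₀ ≤ p →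
  m * p ≤ W → wL + W ≤ Bi + wA → Bi < p → ℓ + m ≤ d * a
exchange-stop {ℓ = ℓ} {m = zero} E ℓ≤ _ _ _ _ = subst (_≤ _) (sym (+-identityʳ ℓ)) ℓ≤
exchange-stop {d} {a} {wA} {ℓ} {wL} {p = p} {suc k} {W} {Bi} E ℓ≤ c₀≤p mp≤W within over
  with ℓ + suc k ≤? d * a
... | yes fits = fits
... | no more = contradiction (begin-strict
      wA + p              ≤⟨ outweighs E k p c₀≤p (≰⇒> more) ⟩
      wL + suc k * p      ≤⟨ +-monoʳ-≤ wL mp≤W ⟩
      wL + W              ≤⟨ within ⟩
      Bi + wA             <⟨ +-monoˡ-< wA over ⟩
      p + wA              ≡⟨ +-comm p wA ⟩
      wA + p              ∎) (<-irrefl refl)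
  where open ≤-Reasoning

module _ {n : ℕ} (G : Graph n) where

  Near : Fin n → Fin n → Set
  Near a x = x ≡ a ⊎ Edge G a x

  near? : ∀ a → Decidable (Near a)
  near? a x = (x Fin.≟ a) ⊎-dec (adj G a x Bool.≟ true)

  Covered : List (Fin n) → Fin n → Set
  Covered A x = x ∈ A ⊎ Any (λ a → Edge G a x) A

  uncover : ∀ {a A x} → ¬ Near a x → Covered (a ∷ A) x → Covered A x
  uncover far (inj₁ (here x≡a)) = contradiction (inj₁ x≡a) far
  uncover far (inj₁ (there x∈A)) = inj₁ x∈A
  uncover far (inj₂ (here a~x)) = contradiction (inj₂ a~x) far
  uncover far (inj₂ (there some)) = inj₂ some

  cover-more : ∀ {v A x} → Covered A x → Covered (v ∷ A) x
  cover-more (inj₁ x∈A) = inj₁ (there x∈A)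
  cover-more (inj₂ some) = inj₂ (there some)

  neighbour-in : ∀ {v} A → any (λ u → adj G u v) A ≡ true → Any (λ a → Edge G a v) A
  neighbour-in A adjacent =
    Any.map (Equivalence.to T-≡) (any⁻ _ A (Equivalence.from T-≡ adjacent))

  -- In a (d+1)-claw free graph a vertex has at most d distinct neighbours
  -- in an independent set: d+1 of them would be the leaves of a claw.
  neighbours-bound : ∀ {d X} → ClawFree G (d + 1) → Independent G X →
    ∀ a L → Unique L → All (Edge G a) L → All (_∈ₛ X) L → length L ≤ d
  neighbours-bound {d} cf independent a L distinct adjacent L⊆X with length L ≤? d
  ... | yes short = short
  ... | no long = contradiction
        (a , K , length-K , Unique.take⁺ (d + 1) distinct , All.take⁺ (d + 1) adjacent , apart) cf
    where
    K = take (d + 1) L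
    length-K : length K ≡ d + 1
    length-K = trans (length-take (d + 1) L) (m≤n⇒m⊓n≡m (subst (_≤ length L) (+-comm 1 d) (≰⇒> long)))
    apart : ∀ u v → u ∈ K → v ∈ K → ¬ Edge G u v
    apart u v u∈K v∈K = independent u v (All.lookup inK u∈K) (All.lookup inK v∈K)
      where inK = All.take⁺ (d + 1) L⊆X

  -- A vertex a is near at most d distinct vertices of an independent set X:
  -- only a itself if a ∈ X, and only neighbours of a otherwise.
  near-bound : ∀ {d X} → 1 ≤ d → ClawFree G (d + 1) → Independent G X →
    ∀ a L → Unique L → All (_∈ₛ X) L → All (Near a) L → length L ≤ d
  near-bound {X = X} 1≤d cf independent a L distinct L⊆X near with a ∈ₛ? X
  ... | yes a∈X = ≤-trans (unique-constant L distinct (All.zipWith equal (L⊆X , near))) 1≤d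
    where
    equal : ∀ {x} → x ∈ₛ X × Near a x → x ≡ a
    equal (_ , inj₁ x≡a) = x≡a
    equal (x∈X , inj₂ a~x) = contradiction a~x (independent _ _ a∈X x∈X)
  ... | no a∉X = neighbours-bound cf independent a L distinct (All.zipWith adjacent (L⊆X , near)) L⊆X
    where
    adjacent : ∀ {x} → x ∈ₛ X × Near a x → Edge G a x
    adjacent (x∈X , inj₁ refl) = contradiction x∈X a∉X
    adjacent (_ , inj₂ a~x) = a~x

  coverage-bound : ∀ {d X} → 1 ≤ d → ClawFree G (d + 1) → Independent G X →
    ∀ A L → Unique L → All (_∈ₛ X) L → All (Covered A) L → length L ≤ d * length A
  coverage-bound 1≤d cf independent [] [] _ _ _ = z≤n
  coverage-bound 1≤d cf independent [] (x ∷ L) _ _ (inj₁ () ∷ _)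
  coverage-bound 1≤d cf independent [] (x ∷ L) _ _ (inj₂ () ∷ _)
  coverage-bound {d} 1≤d cf independent (a ∷ A) L distinct L⊆X covered = begin
    length L                              ≡⟨ length-split (near? a) L ⟩
    length nearby + length farther        ≤⟨ +-mono-≤ nearby-bound farther-bound ⟩
    d + d * length A                      ≡⟨ *-suc d (length A) ⟨
    d * length (a ∷ A)                    ∎
    where
    open ≤-Reasoning
    nearby = filter (near? a) L
    farther = filter (∁? (near? a)) L
    nearby-bound : length nearby ≤ d
    nearby-bound = near-bound 1≤d cf independent a nearby
      (Unique.filter⁺ (near? a) distinct) (All.filter⁺ (near? a) L⊆X) (all-filter (near? a) L)
    farther-bound : length farther ≤ d * length A
    farther-bound = coverage-bound 1≤d cf independent A farther
      (Unique.filter⁺ (∁? (near? a)) distinct) (All.filter⁺ (∁? (near? a)) L⊆X)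
      (All.zipWith (λ (far , cov) → uncover far cov)
        (all-filter (∁? (near? a)) L , All.filter⁺ (∁? (near? a)) covered))

move-head : ∀ w p r → w + (p + r) ≡ p + w + r
move-head w p r = trans (sym (+-assoc w p r)) (cong (_+ r) (+-comm w p))

spend : ∀ {B p} w → p ≤ B → B ∸ p + (p + w) ≡ B + w
spend {B} {p} w p≤B = trans (sym (+-assoc (B ∸ p) p w)) (cong (_+ w) (m∸n+n≡m p≤B))

module Analysis {n} (d : ℕ) (1≤d : 1 ≤ d) (G : Graph n) (cf : ClawFree G (d + 1))
                (b : Fin n → ℕ) (sorted : Sorted b)
                (X : Subset n) (independent : Independent G X) where

  inX : List (Fin n) → List (Fin n)
  inX = filter (_∈ₛ? X)

  -- State of the analysis while MBF has remaining budget Bi, current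
  -- solution A and remaining vertices vs; Lx lists the scanned vertices of
  -- X, and c₀ (the price of the last scanned vertex) is a lower bound on
  -- the prices of the remaining ones.
  record Invariant (Bi : ℕ) (A vs Lx : List (Fin n)) (c₀ : ℕ) : Set where
    field
      ascending : AllPairs Fin._<_ vs
      unseen    : All (_∉ Lx) vs
      distinct  : Unique Lx
      inside-X  : All (_∈ₛ X) Lx
      covered   : All (Covered G A) Lx
      pricier   : All (λ w → c₀ ≤ b w) vs
      exchange  : Exchange d (length A) (weight b A) (length Lx) (weight b Lx) c₀
      -- X fits into the budget B = Bi + weight b A
      within    : weight b Lx + weight b (inX vs) ≤ Bi + weight b A

  open Invariant

  head-in : ∀ {v vs} → v ∈ₛ X → inX (v ∷ vs) ≡ v ∷ inX vs
  head-in = filter-accept (_∈ₛ? X)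

  head-out : ∀ {v vs} → ¬ v ∈ₛ X → inX (v ∷ vs) ≡ inX vs
  head-out = filter-reject (_∈ₛ? X)

  scanned-bound : ∀ {Bi A vs Lx c₀} → Invariant Bi A vs Lx c₀ → length Lx ≤ d * length A
  scanned-bound {A = A} {Lx = Lx} inv =
    coverage-bound G 1≤d cf independent A Lx (distinct inv) (inside-X inv) (covered inv)

  later-pricier : ∀ {v vs} → All (v Fin.<_) vs → All (λ w → b v ≤ b w) vs
  later-pricier = All.map (λ v<w → sorted _ _ (<⇒≤ v<w))

  later-unseen : ∀ {v vs Lx} → All (v Fin.<_) vs → All (_∉ Lx) vs → All (_∉ v ∷ Lx) vs
  later-unseen v<vs unseen = All.zipWith fresh (v<vs , unseen)
    where
    fresh : ∀ {v w : Fin n} {Lx} → v Fin.< w × w ∉ Lx → w ∉ v ∷ Lx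
    fresh (v<w , w∉Lx) (here refl) = <-irrefl refl v<w
    fresh (v<w , w∉Lx) (there w∈Lx) = w∉Lx w∈Lx

  reject-in : ∀ {Bi A v vs Lx c₀} → Invariant Bi A (v ∷ vs) Lx c₀ →
    Any (λ a → Edge G a v) A → v ∈ₛ X → Invariant Bi A vs (v ∷ Lx) (b v)
  reject-in {Bi} {A} {v} {vs} {Lx} inv neighbour v∈X = record
    { ascending = AllPairs.tail (ascending inv)
    ; unseen    = later-unseen v<vs (All.tail (unseen inv))
    ; distinct  = ¬Any⇒All¬ Lx (All.head (unseen inv)) ∷ distinct inv
    ; inside-X  = v∈X ∷ inside-X inv
    ; covered   = inj₂ neighbour ∷ covered inv
    ; pricier   = later-pricier v<vs
    ; exchange  = exchange-cover (exchange inv) (All.head (pricier inv))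
    ; within    = begin
        b v + weight b Lx + weight b (inX vs)   ≡⟨ move-head (weight b Lx) (b v) (weight b (inX vs)) ⟨
        weight b Lx + weight b (v ∷ inX vs)     ≡⟨ cong (λ R → weight b Lx + weight b R) (head-in v∈X) ⟨
        weight b Lx + weight b (inX (v ∷ vs))   ≤⟨ within inv ⟩
        Bi + weight b A                         ∎
    }
    where
    open ≤-Reasoning
    v<vs = AllPairs.head (ascending inv)

  pass-out : ∀ {Bi A v vs Lx c₀} → Invariant Bi A (v ∷ vs) Lx c₀ → ¬ v ∈ₛ X →
    Invariant Bi A vs Lx (b v)
  pass-out {Bi} {A} {v} {vs} {Lx} inv v∉X = record
    { ascending = AllPairs.tail (ascending inv)
    ; unseen    = All.tail (unseen inv)
    ; distinct  = distinct inv
    ; inside-X  = inside-X inv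
    ; covered   = covered inv
    ; pricier   = later-pricier (AllPairs.head (ascending inv))
    ; exchange  = exchange-raise (exchange inv) (All.head (pricier inv))
    ; within    = subst (λ R → weight b Lx + weight b R ≤ Bi + weight b A)
                    (head-out v∉X) (within inv)
    }

  accept-in : ∀ {Bi A v vs Lx c₀} → Invariant Bi A (v ∷ vs) Lx c₀ → b v ≤ Bi → v ∈ₛ X →
    Invariant (Bi ∸ b v) (v ∷ A) vs (v ∷ Lx) (b v)
  accept-in {Bi} {A} {v} {vs} {Lx} inv fits v∈X = record
    { ascending = AllPairs.tail (ascending inv)
    ; unseen    = later-unseen v<vs (All.tail (unseen inv))
    ; distinct  = ¬Any⇒All¬ Lx (All.head (unseen inv)) ∷ distinct inv
    ; inside-X  = v∈X ∷ inside-X inv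
    ; covered   = inj₁ (here refl) ∷ All.map (cover-more G) (covered inv)
    ; pricier   = later-pricier v<vs
    ; exchange  = exchange-accept-cover 1≤d (exchange inv) (All.head (pricier inv))
    ; within    = begin
        b v + weight b Lx + weight b (inX vs)   ≡⟨ move-head (weight b Lx) (b v) (weight b (inX vs)) ⟨
        weight b Lx + weight b (v ∷ inX vs)     ≡⟨ cong (λ R → weight b Lx + weight b R) (head-in v∈X) ⟨
        weight b Lx + weight b (inX (v ∷ vs))   ≤⟨ within inv ⟩
        Bi + weight b A                         ≡⟨ spend (weight b A) fits ⟨
        Bi ∸ b v + (b v + weight b A)           ∎
    }
    where
    open ≤-Reasoning
    v<vs = AllPairs.head (ascending inv)

  -- An accepted vertex outside X joins the solution only; the covering bound
  -- on the scanned vertices keeps the exchange invariant alive.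
  accept-out : ∀ {Bi A v vs Lx c₀} → Invariant Bi A (v ∷ vs) Lx c₀ → b v ≤ Bi → ¬ v ∈ₛ X →
    Invariant (Bi ∸ b v) (v ∷ A) vs Lx (b v)
  accept-out {Bi} {A} {v} {vs} {Lx} inv fits v∉X = record
    { ascending = AllPairs.tail (ascending inv)
    ; unseen    = All.tail (unseen inv)
    ; distinct  = distinct inv
    ; inside-X  = inside-X inv
    ; covered   = All.map (cover-more G) (covered inv)
    ; pricier   = later-pricier (AllPairs.head (ascending inv))
    ; exchange  = exchange-accept 1≤d (scanned-bound inv) (exchange inv) (All.head (pricier inv))
    ; within    = begin
        weight b Lx + weight b (inX vs)         ≡⟨ cong (λ R → weight b Lx + weight b R) (head-out v∉X) ⟨
        weight b Lx + weight b (inX (v ∷ vs))   ≤⟨ within inv ⟩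
        Bi + weight b A                         ≡⟨ spend (weight b A) fits ⟨
        Bi ∸ b v + (b v + weight b A)           ∎
    }
    where open ≤-Reasoning

  stop-bound : ∀ {Bi A v vs Lx c₀} → Invariant Bi A (v ∷ vs) Lx c₀ → Bi < b v →
    length Lx + length (inX (v ∷ vs)) ≤ d * length A
  stop-bound {v = v} {vs} inv over =
    exchange-stop (exchange inv) (scanned-bound inv) (All.head (pricier inv)) remaining-cost (within inv) over
    where
    remaining-cost : length (inX (v ∷ vs)) * b v ≤ weight b (inX (v ∷ vs))
    remaining-cost = weight-lower b (inX (v ∷ vs))
      (All.filter⁺ (_∈ₛ? X) (≤-refl ∷ later-pricier (AllPairs.head (ascending inv))))

  scan-bound : ∀ Bi A vs Lx c₀ → Invariant Bi A vs Lx c₀ →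
    length Lx + length (inX vs) ≤ d * length (mbfLoop G b Bi A vs)
  scan-bound Bi A [] Lx c₀ inv = subst (_≤ _) (sym (+-identityʳ (length Lx))) (scanned-bound inv)
  scan-bound Bi A (v ∷ vs) Lx c₀ inv with Bi <? b v
  ... | yes over = stop-bound inv over
  ... | no fits with any (λ u → adj G u v) A in adjacent | v ∈ₛ? X
  ...   | true  | yes v∈X = move-one v Lx (inX vs)
          (scan-bound Bi A vs (v ∷ Lx) (b v) (reject-in inv (neighbour-in G A adjacent) v∈X))
  ...   | true  | no v∉X  =
          scan-bound Bi A vs Lx (b v) (pass-out inv v∉X)
  ...   | false | yes v∈X = move-one v Lx (inX vs)
          (scan-bound (Bi ∸ b v) (v ∷ A) vs (v ∷ Lx) (b v) (accept-in inv (≮⇒≥ fits) v∈X))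
  ...   | false | no v∉X  =
          scan-bound (Bi ∸ b v) (v ∷ A) vs Lx (b v) (accept-out inv (≮⇒≥ fits) v∉X)

  initial : ∀ B → weight b (inX (allFin n)) ≤ B → Invariant B [] (allFin n) [] 0
  initial B within-B = record
    { ascending = AllPairsₚ.tabulate⁺-< (λ i<j → i<j)
    ; unseen    = All.universal (λ _ ()) (allFin n)
    ; distinct  = []
    ; inside-X  = []
    ; covered   = []
    ; pricier   = All.universal (λ _ → z≤n) (allFin n)
    ; exchange  = exchange-initial d 0
    ; within    = subst (_ ≤_) (sym (+-identityʳ B)) within-B
    }

  run-bound : ∀ B → weight b (inX (allFin n)) ≤ B →
    length (inX (allFin n)) ≤ d * length (mbfLoop G b B [] (allFin n))
  run-bound B within-B = scan-bound B [] (allFin n) [] 0 (initial B within-B)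

-- Starting the loop from the empty solution performs MBF, except that it
-- may stop before taking the first vertex; so it returns no more vertices.
mbf-from-empty : ∀ {n} (G : Graph n) b B → length (mbfLoop G b B [] (allFin n)) ≤ length (mbf G b B)
mbf-from-empty {zero} G b B = z≤n
mbf-from-empty {suc n} G b B with B <? b zero
... | yes _ = z≤n
... | no _  = ≤-refl

lemma2 : (d n : ℕ) → 1 ≤ d → (G : Graph n) → ClawFree G (d + 1) →
    (b : Fin n → ℕ) → (∀ v → 1 ≤ b v) → Sorted b →
    (B : ℕ) → 1 ≤ B →
    (Astar : Subset n) → MaxBudgetedIndependent G b B Astar →
    ∣ Astar ∣ ≤ d * length (mbf G b B)
lemma2 d n 1≤d G cf b _ sorted B _ X ((independent , within-B) , _) = begin
  ∣ X ∣                                      ≡⟨ size-members X ⟩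
  length (members X)                         ≡⟨ cong length (members-filter X) ⟩
  length (filter (_∈ₛ? X) (allFin n))        ≤⟨ run-bound B (subst (λ M → weight b M ≤ B) (members-filter X) within-B) ⟩
  d * length (mbfLoop G b B [] (allFin n))   ≤⟨ *-monoʳ-≤ d (mbf-from-empty G b B) ⟩
  d * length (mbf G b B)                     ∎
  where
  open ≤-Reasoning
  open Analysis d 1≤d G cf b sorted X independent
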